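{- Let $m \geq 2$. Then \[ T_{0} + \bigcup_{1 \leq j < m} \mathrm{IND}^{j}(\mathrm{Open}(\mathcal{L}_{A})) \not\vdash I^{m}_{X}\, A(X), \] i.e. the $m$-step induction axiom for the atomic formula $A(X)$ is not provable in $T_0$ together with quantifier-free $j$-step induction over $\mathcal{L}_A$ for all $1 \leq j < m$.
   Context: We work in classical many-sorted first-order logic with equality. The language $\mathcal{L}_{0}$ has two sorts, $\mathsf{i}$ (elements) and $\mathsf{list}$, and function symbols $\mathit{nil}:\mathsf{list}$ and $\mathit{cons}:\mathsf{i}\times\mathsf{list}\to\mathsf{list}$. The language $\mathcal{L}_{A}$ extends $\mathcal{L}_{0}$ by a unary predicate symbol $A:\mathsf{list}\to o$. The theory $T_{0}$ is axiomatized by the universal closures of $\mathit{nil} \neq \mathit{cons}(x,X)$ and $\mathit{cons}(x,X) = \mathit{cons}(y,Y) \rightarrow x = y \wedge X = Y$. For terms $t_1,\dots,t_n$ of sort $\mathsf{i}$ and a term $T$ of sort $\mathsf{list}$, $\mathit{cons}(t_1,\dots,t_n;T)$ abbreviates $\mathit{cons}(t_1,\mathit{cons}(t_2,\dots,\mathit{cons}(t_n,T)\dots))$ (this is $T$ when $n=0$). For a formula $\varphi(X,\vec z)$ and $m\ge 1$, the $m$-step induction axiom $I^{m}_{X}\varphi$ is \[ \Big(\bigwedge_{i=1}^{m} \forall x_1\dots\forall x_{i-1}\, \varphi(\mathit{cons}(x_1,\dots,x_{i-1};\mathit{nil}),\vec z) \wedge \forall X\,\forall x_1\dots\forall x_m\,\big(\varphi(X,\vec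 z)\rightarrow \varphi(\mathit{cons}(x_1,\dots,x_m;X),\vec z)\big)\Big) \rightarrow \forall X\,\varphi(X,\vec z). \] For a set of formulas $\Phi$, $\mathrm{IND}^{m}(\Phi)$ is the theory axiomatized by the universal closures of $I^{m}_{X}\varphi$ for $\varphi(X,\vec z)\in\Phi$. $\mathrm{Open}(\mathcal{L})$ denotes the set of quantifier-free $\mathcal{L}$-formulas. -}

module Defs where

open import Data.Nat using (ℕ; zero; suc; _≤_; _<_)
open import Data.List using (List; []; _∷_; map; foldr; upTo)
open import Data.List.Membership.Propositional using (_∈_)
open import Data.Vec using (Vec; []; _∷_; _∷ʳ_) renaming (map to vmap; foldr′ to vfoldr)
open import Data.Empty using (⊥)

data Sort : Set where
  ι    : Sort
  list : Sort

Ctx : Set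
Ctx = List Sort

infix 4 _∋_
data _∋_ : Ctx → Sort → Set where
  here  : ∀ {Γ s} → (s ∷ Γ) ∋ s
  there : ∀ {Γ s t} → Γ ∋ s → (t ∷ Γ) ∋ s

data Term (Γ : Ctx) : Sort → Set where
  var  : ∀ {s} → Γ ∋ s → Term Γ s
  nil  : Term Γ list
  cons : Term Γ ι → Term Γ list → Term Γ list

infixr 5 _⇒_
infix 7 _≐_
data Formula (Γ : Ctx) : Set where
  ⊥'  : Formula Γ
  _≐_ : ∀ {s} → Term Γ s → Term Γ s → Formula Γ
  A   : Term Γ list → Formula Γ
  _⇒_ : Formula Γ → Formula Γ → Formula Γ
  ∀'  : (s : Sort) → Formula (s ∷ Γ) → Formula Γ

¬' : ∀ {Γ} → Formula Γ → Formula Γ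
¬' φ = φ ⇒ ⊥'

⊤' : ∀ {Γ} → Formula Γ
⊤' = ¬' ⊥'

infixr 6 _∧'_
_∧'_ : ∀ {Γ} → Formula Γ → Formula Γ → Formula Γ
φ ∧' ψ = ¬' (φ ⇒ ¬' ψ)

data QF {Γ : Ctx} : Formula Γ → Set where
  qf-⊥ : QF ⊥'
  qf-≐ : ∀ {s} (t u : Term Γ s) → QF (t ≐ u)
  qf-A : (t : Term Γ list) → QF (A t)
  qf-⇒ : ∀ {φ ψ} → QF φ → QF ψ → QF (φ ⇒ ψ)

Ren : Ctx → Ctx → Set
Ren Γ Δ = ∀ {s} → Γ ∋ s → Δ ∋ s

liftR : ∀ {Γ Δ s} → Ren Γ Δ → Ren (s ∷ Γ) (s ∷ Δ)
liftR ρ here      = here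
liftR ρ (there v) = there (ρ v)

renT : ∀ {Γ Δ s} → Ren Γ Δ → Term Γ s → Term Δ s
renT ρ (var v)    = var (ρ v)
renT ρ nil        = nil
renT ρ (cons t u) = cons (renT ρ t) (renT ρ u)

ren : ∀ {Γ Δ} → Ren Γ Δ → Formula Γ → Formula Δ
ren ρ ⊥'       = ⊥'
ren ρ (t ≐ u)  = renT ρ t ≐ renT ρ u
ren ρ (A t)    = A (renT ρ t)
ren ρ (φ ⇒ ψ)  = ren ρ φ ⇒ ren ρ ψ
ren ρ (∀' s φ) = ∀' s (ren (liftR ρ) φ)

wk : ∀ {Γ s} → Formula Γ → Formula (s ∷ Γ)
wk = ren there

noVar : ∀ {Γ s} → [] ∋ s → Γ ∋ s
noVar ()

wkSentence : ∀ {Γ} → Formula [] → Formula Γ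
wkSentence = ren noVar

Sub : Ctx → Ctx → Set
Sub Γ Δ = ∀ {s} → Γ ∋ s → Term Δ s

liftS : ∀ {Γ Δ s} → Sub Γ Δ → Sub (s ∷ Γ) (s ∷ Δ)
liftS σ here      = var here
liftS σ (there v) = renT there (σ v)

subT : ∀ {Γ Δ s} → Sub Γ Δ → Term Γ s → Term Δ s
subT σ (var v)    = σ v
subT σ nil        = nil
subT σ (cons t u) = cons (subT σ t) (subT σ u)

sub : ∀ {Γ Δ} → Sub Γ Δ → Formula Γ → Formula Δ
sub σ ⊥'       = ⊥'
sub σ (t ≐ u)  = subT σ t ≐ subT σ u
sub σ (A t)    = A (subT σ t)
sub σ (φ ⇒ ψ)  = sub σ φ ⇒ sub σ ψ
sub σ (∀' s φ) = ∀' s (sub (liftS σ) φ)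

single : ∀ {Γ s} → Term Γ s → Sub (s ∷ Γ) Γ
single t here      = t
single t (there v) = var v

_[_] : ∀ {Γ s} → Formula (s ∷ Γ) → Term Γ s → Formula Γ
φ [ t ] = sub (single t) φ

-- Domains are nonempty
-- (rule nonempty), as usual in first-order logic.

data Pf (T : Formula [] → Set) : (Γ : Ctx) → List (Formula Γ) → Formula Γ → Set where
  hyp      : ∀ {Γ Hs φ} → φ ∈ Hs → Pf T Γ Hs φ
  ax       : ∀ {Γ Hs ψ} → T ψ → Pf T Γ Hs (wkSentence ψ)
  ⇒I       : ∀ {Γ Hs φ ψ} → Pf T Γ (φ ∷ Hs) ψ → Pf T Γ Hs (φ ⇒ ψ)
  ⇒E       : ∀ {Γ Hs φ ψ} → Pf T Γ Hs (φ ⇒ ψ) → Pf T Γ Hs φ → Pf T Γ Hs ψ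
  raa      : ∀ {Γ Hs φ} → Pf T Γ (¬' φ ∷ Hs) ⊥' → Pf T Γ Hs φ
  ∀I       : ∀ {Γ Hs s φ} → Pf T (s ∷ Γ) (map wk Hs) φ → Pf T Γ Hs (∀' s φ)
  ∀E       : ∀ {Γ Hs s φ} → Pf T Γ Hs (∀' s φ) → (t : Term Γ s) → Pf T Γ Hs (φ [ t ])
  ≐refl    : ∀ {Γ Hs s} (t : Term Γ s) → Pf T Γ Hs (t ≐ t)
  ≐subst   : ∀ {Γ Hs s} (φ : Formula (s ∷ Γ)) {t u : Term Γ s} →
             Pf T Γ Hs (t ≐ u) → Pf T Γ Hs (φ [ t ]) → Pf T Γ Hs (φ [ u ])
  nonempty : ∀ {Γ Hs φ} (s : Sort) → Pf T (s ∷ Γ) (map wk Hs) (wk φ) → Pf T Γ Hs φ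

infix 3 _⊢_
_⊢_ : (Formula [] → Set) → Formula [] → Set
T ⊢ ψ = Pf T [] [] ψ

ext : ℕ → Ctx → Ctx
ext zero    Γ = Γ
ext (suc k) Γ = ι ∷ ext k Γ

wkExt : ∀ {Γ s} (k : ℕ) → Γ ∋ s → ext k Γ ∋ s
wkExt zero    v = v
wkExt (suc k) v = there (wkExt k v)

∀s : ∀ {Γ} (k : ℕ) → Formula (ext k Γ) → Formula Γ
∀s zero    φ = φ
∀s (suc k) φ = ∀s k (∀' ι φ)

xs : ∀ {Γ} (k : ℕ) → Vec (Term (ext k Γ) ι) k
xs zero    = []
xs (suc k) = vmap (renT there) (xs k) ∷ʳ var here

consAll : ∀ {Γ n} → Vec (Term Γ ι) n → Term Γ list → Term Γ list
consAll ts T = vfoldr cons T ts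

⋀ : ∀ {Γ} → List (Formula Γ) → Formula Γ
⋀ = foldr _∧'_ ⊤'

-- i-th base case, with k = i-1:  ∀x1…∀xk φ(cons(x1,…,xk;nil), z)
baseCase : ∀ {Δ} → Formula (list ∷ Δ) → ℕ → Formula Δ
baseCase {Δ} φ k = ∀s k (sub σ φ)
  where
  σ : Sub (list ∷ Δ) (ext k Δ)
  σ here      = consAll (xs k) nil
  σ (there v) = var (wkExt k v)

stepCase : ∀ {Δ} → ℕ → Formula (list ∷ Δ) → Formula Δ
stepCase {Δ} m φ = ∀' list (∀s m (ren (wkExt m) φ ⇒ sub σ φ))
  where
  σ : Sub (list ∷ Δ) (ext m (list ∷ Δ))
  σ here      = consAll (xs m) (var (wkExt m here))
  σ (there v) = var (wkExt m (there v))

I^ : ∀ {Δ} → ℕ → Formula (list ∷ Δ) → Formula Δ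
I^ m φ = (⋀ (map (baseCase φ) (upTo m)) ∧' stepCase m φ) ⇒ ∀' list φ

close : (Δ : Ctx) → Formula Δ → Formula []
close []      φ = φ
close (s ∷ Δ) φ = close Δ (∀' s φ)

data T0+IND<  (m : ℕ) : Formula [] → Set where
  nil≠cons : T0+IND< m
    (∀' ι (∀' list (¬' (nil ≐ cons (var (there here)) (var here)))))
  cons-inj : T0+IND< m
    (∀' ι (∀' list (∀' ι (∀' list
      (cons (var (there (there (there here)))) (var (there (there here)))
         ≐ cons (var (there here)) (var here)
       ⇒ (var (there (there (there here))) ≐ var (there here)
          ∧' var (there (there here)) ≐ var here))))))
  ind : (j : ℕ) → 1 ≤ j → j < m → (Δ : Ctx) (φ : Formula (list ∷ Δ)) → QF φ →
        T0+IND< m (close Δ (I^ j φ))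

I^A : ℕ → Formula []
I^A m = I^ m (A (var here))

-- A countermodel: lists are the finite lists together with the infinite lists
-- w · ⟨n, n+1, n+2, …⟩, and A holds everywhere except at ⟨n, n+1, …⟩ with m ∣ n.
-- All base cases of I^m A hold, and so does its step, since m letters in front of ⟨n, …⟩
-- give ⟨n−m, …⟩ or a list with an irregular prefix; yet A fails at ⟨0, 1, …⟩.
-- Open j-step induction with j < m holds: an open formula φ(X) cannot distinguish a long
-- finite list of zeros from ⟨N, N+1, …⟩ for N large with m ∤ N, as both are generic for the
-- finitely many terms of φ. So φ, which holds on finite lists by j-step induction, holds at
-- these ⟨N, …⟩; every infinite list arises from one of them by prepending a multiple of j
-- letters, and m ∤ j leaves enough room to pick such an N.

module Submission where

open import Defs
open import Data.Nat using (ℕ; zero; suc; _+_; _*_; _∸_; _≤_; _<_; s≤s; NonZero; >-nonZero; _<?_)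
open import Data.Nat.Properties
open import Data.Nat.Divisibility using (_∣_; _∤_; _∣?_; >⇒∤; ∣m+n∣m⇒∣n; ∣m∣n⇒∣m+n; ∣-refl; _∣0)
open import Data.List using (List; []; _∷_; _++_; length; foldr; map; upTo; replicate; take; drop)
open import Data.List.Properties using (foldr-++; take++drop≡id; length-take; length-drop; length-++; length-replicate; ++-cancelʳ)
import Data.List.Properties as List
open import Data.List.Extrema.Nat using (max; xs≤max)
open import Data.List.Relation.Unary.All as All using (All; []; _∷_)
open import Data.List.Relation.Unary.All.Properties using (map⁺; map⁻; ++⁻ˡ; ++⁻ʳ; applyUpTo⁺₁; applyUpTo⁻)
open import Data.Vec using (Vec; []; _∷_; _∷ʳ_; toList; fromList; reverse) renaming (map to vmap)
open import Data.Vec.Properties using (reverse-involutive; reverse-∷; toList∘fromList; length-toList; map-∷ʳ; map-∘; map-cong)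
open import Data.Product using (∃-syntax; _×_; _,_; proj₁; proj₂)
open import Data.Sum using (_⊎_; inj₁; inj₂)
import Data.Sum.Properties as Sum
import Data.Product.Properties as Product
open import Data.Maybe using (Maybe; just; nothing)
open import Data.Maybe.Properties using (just-injective)
open import Data.Unit using (⊤; tt)
open import Data.Empty using (⊥; ⊥-elim; ⊥-elim-irr)
open import Function using (_∘_)
open import Function.Bundles using (_⇔_; mk⇔; Equivalence; mk↣)
open import Function.Related.TypeIsomorphisms using (→-cong-⇔)
open import Function.Properties.Equivalence using (⇔-isEquivalence)
open import Level using (0ℓ)
open import Relation.Binary.Structures using (IsEquivalence)
open import Relation.Nullary using (¬_; Dec; yes; no; ¬?; Stable)
open import Relation.Nullary.Decidable using (decidable-stable; via-injection)
open import Relation.Unary using (Decidable)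
open import Relation.Binary.Definitions using (DecidableEquality)
open import Relation.Binary.PropositionalEquality hiding ([_])

open Equivalence using (to; from)

private
  variable
    Γ Δ : Ctx
    s : Sort

module ⇔ = IsEquivalence (⇔-isEquivalence {ℓ = 0ℓ})

Π-cong-⇔ : ∀ {D : Set} {P Q : D → Set} → (∀ d → P d ⇔ Q d) → (∀ d → P d) ⇔ (∀ d → Q d)
Π-cong-⇔ P⇔Q = mk⇔ (λ p d → to (P⇔Q d) (p d)) (λ q d → from (P⇔Q d) (q d))

toList-reverse-surjective : ∀ {A : Set} {k} (w : List A) → length w ≡ k →
                            ∃[ v ] toList (reverse {n = k} v) ≡ w
toList-reverse-surjective w refl =
  reverse (fromList w) , trans (cong toList (reverse-involutive (fromList w))) (toList∘fromList w)

Π-Vec⇔Π-List : ∀ {A : Set} {k} (Q : List A → Set) →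
               ((v : Vec A k) → Q (toList (reverse v))) ⇔ (∀ w → length w ≡ k → Q w)
Π-Vec⇔Π-List Q = mk⇔
  (λ f w |w|≡k → let v , v≡w = toList-reverse-surjective w |w|≡k in subst Q v≡w (f v))
  (λ g v → g (toList (reverse v)) (length-toList (reverse v)))

length-take-≤ : ∀ {A : Set} {j} (w : List A) → j ≤ length w → length (take j w) ≡ j
length-take-≤ {j = j} w j≤|w| = trans (length-take j w) (m≤n⇒m⊓n≡m j≤|w|)

padding : ∀ {m j} → 1 ≤ j → m ∤ j → ∀ u n K → ∃[ r ] ∃[ Q ] u + r ≡ Q * j × K ≤ n + r × m ∤ n + r
padding {m} {j} j≥1 m∤j u n K = choose (m ∣? n + r₀)
  where
  instance
    j≢0 : NonZero j
    j≢0 = >-nonZero j≥1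
  Q₀ r₀ : ℕ
  Q₀ = u + K
  r₀ = Q₀ * j ∸ u
  u+r₀≡Q₀j : u + r₀ ≡ Q₀ * j
  u+r₀≡Q₀j = m+[n∸m]≡n (≤-trans (m≤m+n u K) (m≤m*n Q₀ j))
  K≤n+r₀ : K ≤ n + r₀
  K≤n+r₀ = ≤-trans (subst (_≤ r₀) (m+n∸m≡n u K) (∸-monoˡ-≤ u (m≤m*n Q₀ j))) (m≤n+m r₀ n)
  choose : Dec (m ∣ n + r₀) → ∃[ r ] ∃[ Q ] u + r ≡ Q * j × K ≤ n + r × m ∤ n + r
  choose (no m∤n+r₀)  = r₀ , Q₀ , u+r₀≡Q₀j , K≤n+r₀ , m∤n+r₀
  choose (yes m∣n+r₀) = r₀ + j , suc Q₀
    , trans (sym (+-assoc u r₀ j)) (trans (cong (_+ j) u+r₀≡Q₀j) (+-comm (Q₀ * j) j))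
    , ≤-trans K≤n+r₀ (+-monoʳ-≤ n (m≤m+n r₀ j))
    , λ m∣n+r₀+j → m∤j (∣m+n∣m⇒∣n (subst (m ∣_) (sym (+-assoc n r₀ j)) m∣n+r₀+j) m∣n+r₀)

record Structure : Set₁ where
  infixr 5 _◃_
  field
    Elem Seq : Set
    elem     : Elem
    nilᴹ     : Seq
    consᴹ    : Elem → Seq → Seq
    Aᴹ       : Seq → Set
    Aᴹ?      : Decidable Aᴹ
    _≟ᴱ_     : DecidableEquality Elem
    _≟ˢ_     : DecidableEquality Seq

  _◃_ : List Elem → Seq → Seq
  w ◃ X = foldr consᴹ X w

module Semantics (M : Structure) where
  open Structure M

  Val : Sort → Set
  Val ι    = Elem
  Val list = Seq

  Env : Ctx → Set
  Env Γ = ∀ {s} → Γ ∋ s → Val s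

  infixr 5 _∷ᵉ_
  _∷ᵉ_ : Val s → Env Γ → Env (s ∷ Γ)
  (d ∷ᵉ e) here      = d
  (d ∷ᵉ e) (there v) = e v

  []ᵉ : Env []
  []ᵉ ()

  ⟦_⟧ᵗ : Term Γ s → Env Γ → Val s
  ⟦ var v ⟧ᵗ    e = e v
  ⟦ nil ⟧ᵗ      e = nilᴹ
  ⟦ cons t u ⟧ᵗ e = consᴹ (⟦ t ⟧ᵗ e) (⟦ u ⟧ᵗ e)

  ⟦_⟧ : Formula Γ → Env Γ → Set
  ⟦ ⊥' ⟧     e = ⊥
  ⟦ t ≐ u ⟧  e = ⟦ t ⟧ᵗ e ≡ ⟦ u ⟧ᵗ e
  ⟦ A t ⟧    e = Aᴹ (⟦ t ⟧ᵗ e)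
  ⟦ φ ⇒ ψ ⟧  e = ⟦ φ ⟧ e → ⟦ ψ ⟧ e
  ⟦ ∀' s φ ⟧ e = (d : Val s) → ⟦ φ ⟧ (d ∷ᵉ e)

  ⊨_ : Formula [] → Set
  ⊨ ψ = ⟦ ψ ⟧ []ᵉ

  _≟ᵛ_ : DecidableEquality (Val s)
  _≟ᵛ_ {ι}    = _≟ᴱ_
  _≟ᵛ_ {list} = _≟ˢ_

  -- Decidability of the atoms is what makes this Set-valued semantics sound for the classical rule raa.
  ⟦⟧-stable : (φ : Formula Γ) (e : Env Γ) → Stable (⟦ φ ⟧ e)
  ⟦⟧-stable ⊥'            e ¬¬p   = ¬¬p (λ p → p)
  ⟦⟧-stable (_≐_ {s} t u) e       = decidable-stable (_≟ᵛ_ {s} (⟦ t ⟧ᵗ e) (⟦ u ⟧ᵗ e))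
  ⟦⟧-stable (A t)         e       = decidable-stable (Aᴹ? (⟦ t ⟧ᵗ e))
  ⟦⟧-stable (φ ⇒ ψ)       e ¬¬f p = ⟦⟧-stable ψ e (λ ¬q → ¬¬f (λ f → ¬q (f p)))
  ⟦⟧-stable (∀' s φ)      e ¬¬f d = ⟦⟧-stable φ (d ∷ᵉ e) (λ ¬q → ¬¬f (λ f → ¬q (f d)))

  ⟦renT⟧ : (ρ : Ren Γ Δ) {e : Env Γ} {e′ : Env Δ} → (∀ {s} (v : Γ ∋ s) → e′ (ρ v) ≡ e v) →
           (t : Term Γ s) → ⟦ renT ρ t ⟧ᵗ e′ ≡ ⟦ t ⟧ᵗ e
  ⟦renT⟧ ρ h (var v)    = h v
  ⟦renT⟧ ρ h nil        = refl
  ⟦renT⟧ ρ h (cons t u) = cong₂ consᴹ (⟦renT⟧ ρ h t) (⟦renT⟧ ρ h u)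

  ⟦ren⟧ : (ρ : Ren Γ Δ) {e : Env Γ} {e′ : Env Δ} → (∀ {s} (v : Γ ∋ s) → e′ (ρ v) ≡ e v) →
          (φ : Formula Γ) → ⟦ ren ρ φ ⟧ e′ ⇔ ⟦ φ ⟧ e
  ⟦ren⟧ ρ h ⊥'       = ⇔.refl
  ⟦ren⟧ ρ h (t ≐ u)  = ⇔.reflexive (cong₂ _≡_ (⟦renT⟧ ρ h t) (⟦renT⟧ ρ h u))
  ⟦ren⟧ ρ h (A t)    = ⇔.reflexive (cong Aᴹ (⟦renT⟧ ρ h t))
  ⟦ren⟧ ρ h (φ ⇒ ψ)  = →-cong-⇔ (⟦ren⟧ ρ h φ) (⟦ren⟧ ρ h ψ)
  ⟦ren⟧ ρ h (∀' s φ) = Π-cong-⇔ λ d → ⟦ren⟧ (liftR ρ) (λ { here → refl ; (there v) → h v }) φ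

  ⟦subT⟧ : (σ : Sub Γ Δ) {e : Env Γ} {e′ : Env Δ} → (∀ {s} (v : Γ ∋ s) → ⟦ σ v ⟧ᵗ e′ ≡ e v) →
           (t : Term Γ s) → ⟦ subT σ t ⟧ᵗ e′ ≡ ⟦ t ⟧ᵗ e
  ⟦subT⟧ σ h (var v)    = h v
  ⟦subT⟧ σ h nil        = refl
  ⟦subT⟧ σ h (cons t u) = cong₂ consᴹ (⟦subT⟧ σ h t) (⟦subT⟧ σ h u)

  ⟦sub⟧ : (σ : Sub Γ Δ) {e : Env Γ} {e′ : Env Δ} → (∀ {s} (v : Γ ∋ s) → ⟦ σ v ⟧ᵗ e′ ≡ e v) →
          (φ : Formula Γ) → ⟦ sub σ φ ⟧ e′ ⇔ ⟦ φ ⟧ e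
  ⟦sub⟧ σ h ⊥'       = ⇔.refl
  ⟦sub⟧ σ h (t ≐ u)  = ⇔.reflexive (cong₂ _≡_ (⟦subT⟧ σ h t) (⟦subT⟧ σ h u))
  ⟦sub⟧ σ h (A t)    = ⇔.reflexive (cong Aᴹ (⟦subT⟧ σ h t))
  ⟦sub⟧ σ h (φ ⇒ ψ)  = →-cong-⇔ (⟦sub⟧ σ h φ) (⟦sub⟧ σ h ψ)
  ⟦sub⟧ σ h (∀' s φ) = Π-cong-⇔ λ d →
    ⟦sub⟧ (liftS σ) (λ { here → refl ; (there v) → trans (⟦renT⟧ there (λ _ → refl) (σ v)) (h v) }) φ

  ⟦wk⟧ : (d : Val s) (e : Env Γ) (φ : Formula Γ) → ⟦ wk {s = s} φ ⟧ (d ∷ᵉ e) ⇔ ⟦ φ ⟧ e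
  ⟦wk⟧ d e = ⟦ren⟧ there (λ _ → refl)

  ⟦[]⟧ : (φ : Formula (s ∷ Γ)) (t : Term Γ s) (e : Env Γ) → ⟦ φ [ t ] ⟧ e ⇔ ⟦ φ ⟧ (⟦ t ⟧ᵗ e ∷ᵉ e)
  ⟦[]⟧ φ t e = ⟦sub⟧ (single t) (λ { here → refl ; (there v) → refl }) φ

  inhabitant : (s : Sort) → Val s
  inhabitant ι    = elem
  inhabitant list = nilᴹ

  module _ (T : Formula [] → Set) (⊨T : ∀ {ψ} → T ψ → ⊨ ψ) where

    private
      ⟦_⟧* : List (Formula Γ) → Env Γ → Set
      ⟦ Hs ⟧* e = All (λ φ → ⟦ φ ⟧ e) Hs

      ⟦wk⟧* : (d : Val s) (e : Env Γ) (Hs : List (Formula Γ)) → ⟦ Hs ⟧* e → ⟦ map (wk {s = s}) Hs ⟧* (d ∷ᵉ e)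
      ⟦wk⟧* d e []       []       = []
      ⟦wk⟧* d e (φ ∷ Hs) (p ∷ ps) = from (⟦wk⟧ d e φ) p ∷ ⟦wk⟧* d e Hs ps

    sound : ∀ {Γ Hs φ} → Pf T Γ Hs φ → (e : Env Γ) → ⟦ Hs ⟧* e → ⟦ φ ⟧ e
    sound (hyp φ∈Hs)         e hs = All.lookup hs φ∈Hs
    sound (ax {ψ = ψ} Tψ)    e hs = from (⟦ren⟧ noVar (λ ()) ψ) (⊨T Tψ)
    sound (⇒I p)             e hs = λ a → sound p e (a ∷ hs)
    sound (⇒E p q)           e hs = sound p e hs (sound q e hs)
    sound (raa {φ = φ} p)    e hs = ⟦⟧-stable φ e (λ ¬a → sound p e (¬a ∷ hs))
    sound (∀I {Hs = Hs} p)   e hs = λ d → sound p (d ∷ᵉ e) (⟦wk⟧* d e Hs hs)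
    sound (∀E {φ = φ} p t)   e hs = from (⟦[]⟧ φ t e) (sound p e hs (⟦ t ⟧ᵗ e))
    sound (≐refl t)          e hs = refl
    sound (≐subst φ {t} {u} t≐u p) e hs =
      from (⟦[]⟧ φ u e) (subst (λ d → ⟦ φ ⟧ (d ∷ᵉ e)) (sound t≐u e hs) (to (⟦[]⟧ φ t e) (sound p e hs)))
    sound (nonempty {Hs = Hs} {φ = φ} s p) e hs =
      to (⟦wk⟧ (inhabitant s) e φ) (sound p (inhabitant s ∷ᵉ e) (⟦wk⟧* (inhabitant s) e Hs hs))

    soundness : ∀ {ψ} → T ⊢ ψ → ⊨ ψ
    soundness p = sound p []ᵉ []

  ∧'-⇔-× : (φ ψ : Formula Γ) (e : Env Γ) → ⟦ φ ∧' ψ ⟧ e ⇔ (⟦ φ ⟧ e × ⟦ ψ ⟧ e)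
  ∧'-⇔-× φ ψ e = mk⇔
    (λ p → ⟦⟧-stable φ e (λ ¬a → p (λ a _ → ¬a a)) , ⟦⟧-stable ψ e (λ ¬b → p (λ _ b → ¬b b)))
    (λ (a , b) a→¬b → a→¬b a b)

  ⋀-⇔-All : (Hs : List (Formula Γ)) (e : Env Γ) → ⟦ ⋀ Hs ⟧ e ⇔ All (λ φ → ⟦ φ ⟧ e) Hs
  ⋀-⇔-All []       e = mk⇔ (λ _ → []) (λ _ ff → ff)
  ⋀-⇔-All (φ ∷ Hs) e = mk⇔
    (λ p → let a , as = to (∧'-⇔-× φ (⋀ Hs) e) p in a ∷ to (⋀-⇔-All Hs e) as)
    (λ { (a ∷ as) → from (∧'-⇔-× φ (⋀ Hs) e) (a , from (⋀-⇔-All Hs e) as) })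

  ⊨close : (Δ : Ctx) (ψ : Formula Δ) → ((e : Env Δ) → ⟦ ψ ⟧ e) → ⊨ close Δ ψ
  ⊨close []      ψ ⊨ψ = ⊨ψ []ᵉ
  ⊨close (s ∷ Δ) ψ ⊨ψ = ⊨close Δ (∀' s ψ) (λ e d → ⊨ψ (d ∷ᵉ e))

  -- The head of v is the innermost variable bound by ∀s k, so xs k evaluates to reverse v.
  infixr 5 _++ᵉ_
  _++ᵉ_ : ∀ {k} → Vec Elem k → Env Γ → Env (ext k Γ)
  []      ++ᵉ e = e
  (d ∷ v) ++ᵉ e = d ∷ᵉ v ++ᵉ e

  ⟦∀s⟧ : ∀ k (ψ : Formula (ext k Γ)) (e : Env Γ) → ⟦ ∀s k ψ ⟧ e ⇔ ((v : Vec Elem k) → ⟦ ψ ⟧ (v ++ᵉ e))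
  ⟦∀s⟧ zero    ψ e = mk⇔ (λ p → λ { [] → p }) (λ f → f [])
  ⟦∀s⟧ (suc k) ψ e = mk⇔
    (λ p → λ { (d ∷ v) → to (⟦∀s⟧ k (∀' ι ψ) e) p v d })
    (λ f → from (⟦∀s⟧ k (∀' ι ψ) e) (λ v d → f (d ∷ v)))

  ++ᵉ-wkExt : ∀ k (v : Vec Elem k) (e : Env Γ) (u : Γ ∋ s) → (v ++ᵉ e) (wkExt k u) ≡ e u
  ++ᵉ-wkExt zero    []      e u = refl
  ++ᵉ-wkExt (suc k) (d ∷ v) e u = ++ᵉ-wkExt k v e u

  ⟦xs⟧ : ∀ k (v : Vec Elem k) (e : Env Γ) → vmap (λ t → ⟦ t ⟧ᵗ (v ++ᵉ e)) (xs k) ≡ reverse v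
  ⟦xs⟧ zero    []      e = refl
  ⟦xs⟧ (suc k) (d ∷ v) e = begin
    vmap ⟦_⟧′ (vmap (renT there) (xs k) ∷ʳ var here) ≡⟨ map-∷ʳ ⟦_⟧′ (var here) _ ⟩
    vmap ⟦_⟧′ (vmap (renT there) (xs k)) ∷ʳ d         ≡⟨ cong (_∷ʳ d) (map-∘ ⟦_⟧′ (renT there) (xs k)) ⟨
    vmap (⟦_⟧′ ∘ renT there) (xs k) ∷ʳ d              ≡⟨ cong (_∷ʳ d) (map-cong (⟦renT⟧ there (λ _ → refl)) (xs k)) ⟩
    vmap (λ t → ⟦ t ⟧ᵗ (v ++ᵉ e)) (xs k) ∷ʳ d         ≡⟨ cong (_∷ʳ d) (⟦xs⟧ k v e) ⟩
    reverse v ∷ʳ d                                     ≡⟨ reverse-∷ d v ⟨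
    reverse (d ∷ v)                                    ∎
    where
    open ≡-Reasoning
    ⟦_⟧′ : Term (ext (suc k) _) ι → Elem
    ⟦ t ⟧′ = ⟦ t ⟧ᵗ ((d ∷ v) ++ᵉ e)

  ⟦consAll⟧ : ∀ {n} (ts : Vec (Term Γ ι) n) (T : Term Γ list) (e : Env Γ) →
              ⟦ consAll ts T ⟧ᵗ e ≡ toList (vmap (λ t → ⟦ t ⟧ᵗ e) ts) ◃ ⟦ T ⟧ᵗ e
  ⟦consAll⟧ []       T e = refl
  ⟦consAll⟧ (t ∷ ts) T e = cong (consᴹ (⟦ t ⟧ᵗ e)) (⟦consAll⟧ ts T e)

  ⟦consAll-xs⟧ : ∀ k (v : Vec Elem k) (e : Env Γ) (T : Term (ext k Γ) list) →
                 ⟦ consAll (xs k) T ⟧ᵗ (v ++ᵉ e) ≡ toList (reverse v) ◃ ⟦ T ⟧ᵗ (v ++ᵉ e)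
  ⟦consAll-xs⟧ k v e T =
    trans (⟦consAll⟧ (xs k) T (v ++ᵉ e)) (cong (λ u → toList u ◃ ⟦ T ⟧ᵗ (v ++ᵉ e)) (⟦xs⟧ k v e))

  ⟦_⟧⟨_⟩ : Formula (list ∷ Δ) → Env Δ → Seq → Set
  ⟦ φ ⟧⟨ e ⟩ X = ⟦ φ ⟧ (X ∷ᵉ e)

  Bases Step : ℕ → (Seq → Set) → Set
  Bases k P = ∀ w → length w < k → P (w ◃ nilᴹ)
  Step  k P = ∀ X w → length w ≡ k → P X → P (w ◃ X)

  ⟦baseCase⟧ : (φ : Formula (list ∷ Δ)) (k : ℕ) (e : Env Δ) →
               ⟦ baseCase φ k ⟧ e ⇔ (∀ w → length w ≡ k → ⟦ φ ⟧⟨ e ⟩ (w ◃ nilᴹ))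
  ⟦baseCase⟧ φ k e = ⇔.trans (⟦∀s⟧ k _ e) (⇔.trans
    (Π-cong-⇔ λ v → ⟦sub⟧ _ (λ { here → ⟦consAll-xs⟧ k v e nil ; (there u) → ++ᵉ-wkExt k v e u }) φ)
    (Π-Vec⇔Π-List (λ w → ⟦ φ ⟧⟨ e ⟩ (w ◃ nilᴹ))))

  ⟦stepCase⟧ : (k : ℕ) (φ : Formula (list ∷ Δ)) (e : Env Δ) → ⟦ stepCase k φ ⟧ e ⇔ Step k ⟦ φ ⟧⟨ e ⟩
  ⟦stepCase⟧ k φ e = Π-cong-⇔ λ X → ⇔.trans (⟦∀s⟧ k _ (X ∷ᵉ e)) (⇔.trans
    (Π-cong-⇔ λ v → →-cong-⇔
      (⟦ren⟧ (wkExt k) (++ᵉ-wkExt k v (X ∷ᵉ e)) φ)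
      (⟦sub⟧ _ (λ { here      → trans (⟦consAll-xs⟧ k v (X ∷ᵉ e) _)
                                      (cong (toList (reverse v) ◃_) (++ᵉ-wkExt k v (X ∷ᵉ e) here))
                  ; (there u) → ++ᵉ-wkExt k v (X ∷ᵉ e) (there u) }) φ))
    (Π-Vec⇔Π-List (λ w → ⟦ φ ⟧⟨ e ⟩ X → ⟦ φ ⟧⟨ e ⟩ (w ◃ X))))

  ⟦baseCases⟧ : (k : ℕ) (φ : Formula (list ∷ Δ)) (e : Env Δ) →
                ⟦ ⋀ (map (baseCase φ) (upTo k)) ⟧ e ⇔ Bases k ⟦ φ ⟧⟨ e ⟩
  ⟦baseCases⟧ k φ e = ⇔.trans (⋀-⇔-All _ e) (mk⇔
    (λ all w |w|<k → to (⟦baseCase⟧ φ (length w) e) (applyUpTo⁻ (λ i → i) k (map⁻ all) |w|<k) w refl)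
    (λ bases → map⁺ (applyUpTo⁺₁ (λ i → i) k λ {i} i<k →
       from (⟦baseCase⟧ φ i e) (λ w |w|≡i → bases w (subst (_< k) (sym |w|≡i) i<k)))))

  ⟦I^⟧ : (k : ℕ) (φ : Formula (list ∷ Δ)) (e : Env Δ) →
         ⟦ I^ k φ ⟧ e ⇔ (Bases k ⟦ φ ⟧⟨ e ⟩ → Step k ⟦ φ ⟧⟨ e ⟩ → ∀ X → ⟦ φ ⟧⟨ e ⟩ X)
  ⟦I^⟧ k φ e = ⇔.trans (→-cong-⇔ (∧'-⇔-× (⋀ (map (baseCase φ) (upTo k))) (stepCase k φ) e) ⇔.refl) (mk⇔
    (λ I bases step → I (from (⟦baseCases⟧ k φ e) bases , from (⟦stepCase⟧ k φ e) step))
    (λ I (bases , step) → I (to (⟦baseCases⟧ k φ e) bases) (to (⟦stepCase⟧ k φ e) step)))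

  ◃-split : ∀ j w X → w ◃ X ≡ take j w ◃ drop j w ◃ X
  ◃-split j w X = trans (cong (_◃ X) (sym (take++drop≡id j w))) (foldr-++ consᴹ X (take j w) (drop j w))

  module _ {j : ℕ} {P : Seq → Set} (step : Step j P) where

    Step-iterate : ∀ Q w X → length w ≡ Q * j → P X → P (w ◃ X)
    Step-iterate zero    []  X _    p = p
    Step-iterate (suc Q) w   X |w|≡ p = subst P (sym (◃-split j w X))
      (step (drop j w ◃ X) (take j w) (length-take-≤ w j≤|w|) (Step-iterate Q (drop j w) X |drop| p))
      where
      j≤|w| : j ≤ length w
      j≤|w| = ≤-trans (m≤m+n j (Q * j)) (≤-reflexive (sym |w|≡))
      |drop| : length (drop j w) ≡ Q * j
      |drop| = trans (length-drop j w) (trans (cong (_∸ j) |w|≡) (m+n∸m≡n j (Q * j)))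

    word-induction : 1 ≤ j → Bases j P → ∀ w → P (w ◃ nilᴹ)
    word-induction j≥1 base w = go (length w) w ≤-refl
      where
      go : ∀ n w → length w ≤ n → P (w ◃ nilᴹ)
      go n w |w|≤n with length w <? j
      ... | yes |w|<j = base w |w|<j
      go zero    w |w|≤0   | no |w|≮j = ⊥-elim (|w|≮j (≤-<-trans |w|≤0 j≥1))
      go (suc n) w |w|≤1+n | no |w|≮j = subst P (sym (◃-split j w nilᴹ))
        (step (drop j w ◃ nilᴹ) (take j w) (length-take-≤ w (≮⇒≥ |w|≮j))
          (go n (drop j w) (subst (_≤ n) (sym (length-drop j w)) (∸-mono |w|≤1+n j≥1))))

  data Shape : Set where
    prefix : List Elem → Shape
    const  : Seq → Shape

  ⟦_⟧ˢ : Shape → Seq → Seq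
  ⟦ prefix w ⟧ˢ X = w ◃ X
  ⟦ const c  ⟧ˢ X = c

  consˢ : Elem → Shape → Shape
  consˢ x (prefix w) = prefix (x ∷ w)
  consˢ x (const c)  = const (consᴹ x c)

  ⟦consˢ⟧ : ∀ x S X → ⟦ consˢ x S ⟧ˢ X ≡ consᴹ x (⟦ S ⟧ˢ X)
  ⟦consˢ⟧ x (prefix w) X = refl
  ⟦consˢ⟧ x (const c)  X = refl

  module _ (e : Env Δ) where

    elemᵗ : Term (list ∷ Δ) ι → Elem
    elemᵗ (var (there v)) = e v

    shape : Term (list ∷ Δ) list → Shape
    shape (var here)      = prefix []
    shape (var (there v)) = const (e v)
    shape nil             = const nilᴹ
    shape (cons a t)      = consˢ (elemᵗ a) (shape t)

    ⟦elemᵗ⟧ : ∀ X a → ⟦ a ⟧ᵗ (X ∷ᵉ e) ≡ elemᵗ a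
    ⟦elemᵗ⟧ X (var (there v)) = refl

    ⟦shape⟧ : ∀ X t → ⟦ t ⟧ᵗ (X ∷ᵉ e) ≡ ⟦ shape t ⟧ˢ X
    ⟦shape⟧ X (var here)      = refl
    ⟦shape⟧ X (var (there v)) = refl
    ⟦shape⟧ X nil             = refl
    ⟦shape⟧ X (cons a t)      =
      trans (cong₂ consᴹ (⟦elemᵗ⟧ X a) (⟦shape⟧ X t)) (sym (⟦consˢ⟧ (elemᵗ a) (shape t) X))

    atomShapes : {φ : Formula (list ∷ Δ)} → QF φ → List Shape
    atomShapes qf-⊥               = []
    atomShapes (qf-≐ {ι} t u)     = []
    atomShapes (qf-≐ {list} t u)  = shape t ∷ shape u ∷ []
    atomShapes (qf-A t)           = shape t ∷ []
    atomShapes (qf-⇒ q r)         = atomShapes q ++ atomShapes r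

  record Generic (Small : Shape → Set) (X : Seq) : Set where
    field
      prefix-injective : ∀ {w w′} → Small (prefix w) → Small (prefix w′) → w ◃ X ≡ w′ ◃ X → w ≡ w′
      prefix-fresh     : ∀ {w c} → Small (prefix w) → Small (const c) → w ◃ X ≢ c
      prefix-A         : ∀ {w} → Small (prefix w) → Aᴹ (w ◃ X)

  module _ {Small : Shape → Set} {X Y : Seq} (gX : Generic Small X) (gY : Generic Small Y) where
    open Generic

    ≐-indiscernible : ∀ S S′ → Small S → Small S′ → (⟦ S ⟧ˢ X ≡ ⟦ S′ ⟧ˢ X) ⇔ (⟦ S ⟧ˢ Y ≡ ⟦ S′ ⟧ˢ Y)
    ≐-indiscernible (prefix w) (prefix w′) sw sw′ =
      mk⇔ (cong (_◃ Y) ∘ prefix-injective gX sw sw′) (cong (_◃ X) ∘ prefix-injective gY sw sw′)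
    ≐-indiscernible (prefix w) (const c)   sw sc  =
      mk⇔ (⊥-elim ∘ prefix-fresh gX sw sc) (⊥-elim ∘ prefix-fresh gY sw sc)
    ≐-indiscernible (const c)  (prefix w)  sc sw  =
      mk⇔ (⊥-elim ∘ prefix-fresh gX sw sc ∘ sym) (⊥-elim ∘ prefix-fresh gY sw sc ∘ sym)
    ≐-indiscernible (const c)  (const c′)  _  _   = ⇔.refl

    A-indiscernible : ∀ S → Small S → Aᴹ (⟦ S ⟧ˢ X) ⇔ Aᴹ (⟦ S ⟧ˢ Y)
    A-indiscernible (prefix w) sw = mk⇔ (λ _ → prefix-A gY sw) (λ _ → prefix-A gX sw)
    A-indiscernible (const c)  _  = ⇔.refl

    open-indiscernible : (e : Env Δ) {φ : Formula (list ∷ Δ)} (q : QF φ) → All Small (atomShapes e q) →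
                         ⟦ φ ⟧⟨ e ⟩ X ⇔ ⟦ φ ⟧⟨ e ⟩ Y
    open-indiscernible e qf-⊥ _ = ⇔.refl
    open-indiscernible e (qf-≐ {ι} a b) _ =
      ⇔.reflexive (cong₂ _≡_ (trans (⟦elemᵗ⟧ e X a) (sym (⟦elemᵗ⟧ e Y a)))
                             (trans (⟦elemᵗ⟧ e X b) (sym (⟦elemᵗ⟧ e Y b))))
    open-indiscernible e (qf-≐ {list} t u) (st ∷ su ∷ []) =
      ⇔.trans (⇔.reflexive (cong₂ _≡_ (⟦shape⟧ e X t) (⟦shape⟧ e X u))) (⇔.trans
        (≐-indiscernible (shape e t) (shape e u) st su)
        (⇔.reflexive (sym (cong₂ _≡_ (⟦shape⟧ e Y t) (⟦shape⟧ e Y u)))))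
    open-indiscernible e (qf-A t) (st ∷ []) =
      ⇔.trans (⇔.reflexive (cong Aᴹ (⟦shape⟧ e X t))) (⇔.trans
        (A-indiscernible (shape e t) st)
        (⇔.reflexive (sym (cong Aᴹ (⟦shape⟧ e Y t)))))
    open-indiscernible e (qf-⇒ q r) small = →-cong-⇔
      (open-indiscernible e q (++⁻ˡ (atomShapes e q) small))
      (open-indiscernible e r (++⁻ʳ (atomShapes e q) small))

-- up n is the infinite list ⟨n, n+1, …⟩; pre p is w · ⟨N, N+1, …⟩ with w = letters p nonempty
-- and N = base p, where Breaks forbids the last letter of w to be N − 1, so that every infinite
-- list has exactly one representation.
Breaks : ℕ → ℕ → Set
Breaks x zero    = ⊤
Breaks x (suc n) = x ≢ n

data Prefixed : Set where
  last : (x n : ℕ) → .(Breaks x n) → Prefixed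
  _∷ᵖ_ : ℕ → Prefixed → Prefixed

data Seq : Set where
  fin : List ℕ → Seq
  up  : ℕ → Seq
  pre : Prefixed → Seq

consᴹ : ℕ → Seq → Seq
consᴹ x (fin l)      = fin (x ∷ l)
consᴹ x (up zero)    = pre (last x zero tt)
consᴹ x (up (suc n)) with x ≟ n
... | yes _   = up n
... | no  x≢n = pre (last x (suc n) x≢n)
consᴹ x (pre p)      = pre (x ∷ᵖ p)

uncons : Seq → Maybe (ℕ × Seq)
uncons (fin [])           = nothing
uncons (fin (x ∷ l))      = just (x , fin l)
uncons (up n)             = just (n , up (suc n))
uncons (pre (last x n _)) = just (x , up n)
uncons (pre (x ∷ᵖ p))     = just (x , pre p)

uncons-consᴹ : ∀ x X → uncons (consᴹ x X) ≡ just (x , X)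
uncons-consᴹ x (fin l)      = refl
uncons-consᴹ x (up zero)    = refl
uncons-consᴹ x (up (suc n)) with x ≟ n
... | yes refl = refl
... | no  _    = refl
uncons-consᴹ x (pre p)      = refl

consᴹ-injective : ∀ {x y X Y} → consᴹ x X ≡ consᴹ y Y → x ≡ y × X ≡ Y
consᴹ-injective {x} {y} {X} {Y} eq = Product.,-injective
  (just-injective (trans (sym (uncons-consᴹ x X)) (trans (cong uncons eq) (uncons-consᴹ y Y))))

fin[]≢consᴹ : ∀ x X → fin [] ≢ consᴹ x X
fin[]≢consᴹ x X eq with trans (cong uncons eq) (uncons-consᴹ x X)
... | ()

consᴹ-up : ∀ n → consᴹ n (up (suc n)) ≡ up n
consᴹ-up n with n ≟ n
... | yes _   = refl
... | no  n≢n = ⊥-elim (n≢n refl)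

infixr 5 _◃_
_◃_ : List ℕ → Seq → Seq
w ◃ X = foldr consᴹ X w

letters : Prefixed → List ℕ
letters (last x _ _) = x ∷ []
letters (x ∷ᵖ p)     = x ∷ letters p

base : Prefixed → ℕ
base (last _ n _) = n
base (_ ∷ᵖ p)     = base p

pre-normal : ∀ p → pre p ≡ letters p ◃ up (base p)
pre-normal (last x zero    _) = refl
pre-normal (last x (suc n) x≢n) with x ≟ n
... | yes x≡n = ⊥-elim-irr (x≢n x≡n)
... | no  _   = refl
pre-normal (x ∷ᵖ p)           = cong (consᴹ x) (pre-normal p)

encode : Seq → List ℕ ⊎ (List ℕ × ℕ)
encode (fin l) = inj₁ l
encode (up n)  = inj₂ ([] , n)
encode (pre p) = inj₂ (letters p , base p)

decode : List ℕ ⊎ (List ℕ × ℕ) → Seq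
decode (inj₁ l)       = fin l
decode (inj₂ (w , n)) = w ◃ up n

decode-encode : ∀ X → decode (encode X) ≡ X
decode-encode (fin l) = refl
decode-encode (up n)  = refl
decode-encode (pre p) = sym (pre-normal p)

_≟ˢ_ : DecidableEquality Seq
_≟ˢ_ = via-injection (mk↣ encode-injective)
  (Sum.≡-dec (List.≡-dec _≟_) (Product.≡-dec (List.≡-dec _≟_) _≟_))
  where
  encode-injective : ∀ {X Y} → encode X ≡ encode Y → X ≡ Y
  encode-injective {X} {Y} eq = trans (sym (decode-encode X)) (trans (cong decode eq) (decode-encode Y))

module _ (m : ℕ) where

  Aᴹ : Seq → Set
  Aᴹ (fin _) = ⊤
  Aᴹ (up n)  = m ∤ n
  Aᴹ (pre _) = ⊤

  Aᴹ? : Decidable Aᴹ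
  Aᴹ? (fin _) = yes tt
  Aᴹ? (up n)  = ¬? (m ∣? n)
  Aᴹ? (pre _) = yes tt

𝕄 : ℕ → Structure
𝕄 m = record
  { Elem = ℕ ; Seq = Seq ; elem = 0 ; nilᴹ = fin [] ; consᴹ = consᴹ
  ; Aᴹ = Aᴹ m ; Aᴹ? = Aᴹ? m ; _≟ᴱ_ = _≟_ ; _≟ˢ_ = _≟ˢ_ }

◃-fin : ∀ w l → w ◃ fin l ≡ fin (w ++ l)
◃-fin []      l = refl
◃-fin (x ∷ w) l = cong (consᴹ x) (◃-fin w l)

◃-pre : ∀ w p → ∃[ p′ ] w ◃ pre p ≡ pre p′
◃-pre []      p = p , refl
◃-pre (x ∷ w) p = let p′ , eq = ◃-pre w p in x ∷ᵖ p′ , cong (consᴹ x) eq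

◃-up⁻¹ : ∀ w X n → w ◃ X ≡ up n → X ≡ up (n + length w)
◃-up⁻¹ []      X n eq = trans eq (cong up (sym (+-identityʳ n)))
◃-up⁻¹ (x ∷ w) X n eq = trans (◃-up⁻¹ w X (suc n) w◃X≡) (cong up (sym (+-suc n (length w))))
  where
  w◃X≡ : w ◃ X ≡ up (suc n)
  w◃X≡ = proj₂ (consᴹ-injective (trans eq (sym (consᴹ-up n))))

upFrom : ℕ → ℕ → List ℕ
upFrom n zero    = []
upFrom n (suc r) = n ∷ upFrom (suc n) r

length-upFrom : ∀ n r → length (upFrom n r) ≡ r
length-upFrom n zero    = refl
length-upFrom n (suc r) = cong suc (length-upFrom (suc n) r)

upFrom-◃ : ∀ r n → upFrom n r ◃ up (n + r) ≡ up n
upFrom-◃ zero    n = cong up (+-identityʳ n)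
upFrom-◃ (suc r) n = begin
  consᴹ n (upFrom (suc n) r ◃ up (n + suc r)) ≡⟨ cong (λ k → consᴹ n (upFrom (suc n) r ◃ up k)) (+-suc n r) ⟩
  consᴹ n (upFrom (suc n) r ◃ up (suc n + r)) ≡⟨ cong (consᴹ n) (upFrom-◃ r (suc n)) ⟩
  consᴹ n (up (suc n))                        ≡⟨ consᴹ-up n ⟩
  up n                                        ∎
  where open ≡-Reasoning

◃up-normal : ∀ {N} x w → All (λ y → suc y < N) (x ∷ w) →
             ∃[ p ] (x ∷ w) ◃ up N ≡ pre p × letters p ≡ x ∷ w × base p ≡ N
◃up-normal {suc n} x [] (1+x<1+n ∷ []) with x ≟ n
... | yes refl = ⊥-elim (<-irrefl refl 1+x<1+n)
... | no  x≢n  = last x (suc n) x≢n , refl , refl , refl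
◃up-normal x (y ∷ w) (_ ∷ small) =
  let p , eq , letters≡ , base≡ = ◃up-normal y w small
  in x ∷ᵖ p , cong (consᴹ x) eq , cong (x ∷_) letters≡ , base≡

encode-◃up : ∀ {N} w → All (λ y → suc y < N) w → encode (w ◃ up N) ≡ inj₂ (w , N)
encode-◃up []      _     = refl
encode-◃up (x ∷ w) small =
  let p , eq , letters≡ , base≡ = ◃up-normal x w small
  in trans (cong encode eq) (cong inj₂ (cong₂ _,_ letters≡ base≡))

depth : Seq → ℕ
depth (fin l) = length l
depth (up n)  = n
depth (pre p) = base p

depth-encode : ∀ {w N} X → encode X ≡ inj₂ (w , N) → depth X ≡ N
depth-encode (up n)  refl = refl
depth-encode (pre p) refl = refl

module _ (m : ℕ) where
  open Semantics (𝕄 m)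

  -- Letters of a small prefix are below B − 1, which keeps w ◃ up N in normal form for N ≥ B.
  size : Shape → ℕ
  size (prefix w) = 2 + max 0 w
  size (const c)  = 1 + depth c

  Small : ℕ → Shape → Set
  Small B S = size S ≤ B

  generic-fin : ∀ B → Generic (Small B) (fin (replicate B 0))
  generic-fin B = record
    { prefix-injective = λ {w} {w′} _ _ eq → ++-cancelʳ (replicate B 0) w w′
        (Sum.inj₁-injective (cong encode (trans (sym (◃-fin w _)) (trans eq (◃-fin w′ _)))))
    ; prefix-fresh     = λ {w} {c} _ 1+depth≤B eq → <-irrefl refl (≤-trans 1+depth≤B (≤-trans
        (B≤|w++0ᴮ| w) (≤-reflexive (cong depth (trans (sym (◃-fin w _)) eq)))))
    ; prefix-A         = λ {w} _ → subst (Aᴹ m) (sym (◃-fin w _)) tt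
    }
    where
    B≤|w++0ᴮ| : ∀ w → B ≤ length (w ++ replicate B 0)
    B≤|w++0ᴮ| w = ≤-trans (m≤n+m B (length w))
      (≤-reflexive (sym (trans (length-++ w) (cong (length w +_) (length-replicate B)))))

  generic-up : ∀ {B N} → B ≤ N → m ∤ N → Generic (Small B) (up N)
  generic-up {B} {N} B≤N m∤N = record
    { prefix-injective = λ {w} {w′} sw sw′ eq → proj₁ (Product.,-injective (Sum.inj₂-injective
        (trans (sym (encode-◃up w (below sw))) (trans (cong encode eq) (encode-◃up w′ (below sw′))))))
    ; prefix-fresh     = λ {w} {c} sw sc eq →
        <-irrefl (depth-encode c (trans (cong encode (sym eq)) (encode-◃up w (below sw)))) (≤-trans sc B≤N)
    ; prefix-A         = λ {w} → A-prefix {w}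
    }
    where
    below : ∀ {w} → Small B (prefix w) → All (λ y → suc y < N) w
    below {w} 2+max≤B = All.map (λ y≤max → ≤-trans (s≤s (s≤s y≤max)) (≤-trans 2+max≤B B≤N)) (xs≤max 0 w)
    A-prefix : ∀ {w} → Small B (prefix w) → Aᴹ m (w ◃ up N)
    A-prefix {[]}    _  = m∤N
    A-prefix {x ∷ w} sw = let _ , eq , _ = ◃up-normal x w (below sw) in subst (Aᴹ m) (sym eq) tt

  module OpenInduction {j} (j≥1 : 1 ≤ j) (m∤j : m ∤ j) {Δ} {φ : Formula (list ∷ Δ)} (q : QF φ) (e : Env Δ)
                       (bases : Bases j ⟦ φ ⟧⟨ e ⟩) (step : Step j ⟦ φ ⟧⟨ e ⟩) where

    P : Seq → Set
    P = ⟦ φ ⟧⟨ e ⟩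

    B : ℕ
    B = max 0 (map size (atomShapes e q))

    holds-fin : ∀ l → P (fin l)
    holds-fin l = subst P (trans (◃-fin l []) (cong fin (List.++-identityʳ l))) (word-induction step j≥1 bases l)

    holds-up : ∀ {N} → B ≤ N → m ∤ N → P (up N)
    holds-up B≤N m∤N = to (open-indiscernible (generic-fin B) (generic-up B≤N m∤N) e q small)
                          (holds-fin (replicate B 0))
      where
      small : All (Small B) (atomShapes e q)
      small = map⁻ (xs≤max 0 (map size (atomShapes e q)))

    -- Padding u with n, …, n+r−1 leaves the list unchanged, makes the prefix length a multiple
    -- of j and moves the tail to a generic point up (n + r).
    holds-◃up : ∀ u n → P (u ◃ up n)
    holds-◃up u n with padding j≥1 m∤j (length u) n B
    ... | r , Q , |u|+r≡Qj , B≤n+r , m∤n+r =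
      subst P u′◃up≡u◃up (Step-iterate step Q (u ++ upFrom n r) (up (n + r)) |u′|≡Qj (holds-up B≤n+r m∤n+r))
      where
      |u′|≡Qj : length (u ++ upFrom n r) ≡ Q * j
      |u′|≡Qj = trans (length-++ u) (trans (cong (length u +_) (length-upFrom n r)) |u|+r≡Qj)
      u′◃up≡u◃up : (u ++ upFrom n r) ◃ up (n + r) ≡ u ◃ up n
      u′◃up≡u◃up = trans (foldr-++ consᴹ (up (n + r)) u (upFrom n r)) (cong (u ◃_) (upFrom-◃ r n))

    holds : ∀ X → P X
    holds (fin l) = holds-fin l
    holds (up n)  = holds-◃up [] n
    holds (pre p) = subst P (sym (pre-normal p)) (holds-◃up (letters p) (base p))

  ⊨T0+IND< : ∀ {ψ} → T0+IND< m ψ → ⊨ ψ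
  ⊨T0+IND< nil≠cons = fin[]≢consᴹ
  ⊨T0+IND< cons-inj = λ x X y Y eq k → let x≡y , X≡Y = consᴹ-injective eq in k x≡y X≡Y
  ⊨T0+IND< (ind j j≥1 j<m Δ φ q) = ⊨close Δ (I^ j φ) λ e →
    from (⟦I^⟧ j φ e) (OpenInduction.holds j≥1 (>⇒∤ {{>-nonZero j≥1}} j<m) q e)

  ⊭I^A : ¬ ⊨ I^A m
  ⊭I^A ⊨I^A = to (⟦I^⟧ m (A (var here)) []ᵉ) ⊨I^A A-fin A-step (up 0) (m ∣0)
    where
    A-fin : ∀ w _ → Aᴹ m (w ◃ fin [])
    A-fin w _ = subst (Aᴹ m) (sym (◃-fin w [])) tt
    A-step : ∀ X w → length w ≡ m → Aᴹ m X → Aᴹ m (w ◃ X)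
    A-step (fin l) w _ _ = subst (Aᴹ m) (sym (◃-fin w l)) tt
    A-step (pre p) w _ _ = subst (Aᴹ m) (sym (proj₂ (◃-pre w p))) tt
    A-step (up n)  w |w|≡m m∤n with w ◃ up n in eq
    ... | fin _  = tt
    ... | pre _  = tt
    ... | up n′  = λ m∣n′ → m∤n (subst (m ∣_) n′+m≡n (∣m∣n⇒∣m+n m∣n′ ∣-refl))
      where
      n′+m≡n : n′ + m ≡ n
      n′+m≡n = trans (cong (n′ +_) (sym |w|≡m)) (sym (cong depth (◃-up⁻¹ w (up n) n′ eq)))

-- The countermodel works for every m.
proposition3p6 : (m : ℕ) → 2 ≤ m → ¬ (T0+IND< m ⊢ I^A m)
proposition3p6 m _ ⊢I^A = ⊭I^A m (Semantics.soundness (𝕄 m) (T0+IND< m) (⊨T0+IND< m) ⊢I^A)
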